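{- Let $n\ge 2$. For every $i\in\{1,\dots,n\}$, every finite multiset $\Gamma$ of formulas of the $n$-dimensional propositional calculus $n$PC and every formula $F$ of $n$PC, we have $\Gamma\models_i F$ if and only if the sequent $\Gamma\vdash_i F$ is provable in $n$PC.
   Context: Fix $n\ge 2$, write $\hat n=\{1,\dots,n\}$, let $S_n$ be the group of permutations of $\hat n$ and $V$ a countable set of propositional variables. Formulas of $n$PC are: decorated variables $X^\pi$ ($X\in V$, $\pi\in S_n$); constants $\mathsf e_1,\dots,\mathsf e_n$; compound formulas $q(F,G_1,\dots,G_n)$ with $F,G_1,\dots,G_n$ formulas. For $\rho\in S_n$, $F^\rho$ is defined by $(X^\pi)^\rho=X^{\rho\circ\pi}$, $(\mathsf e_k)^\rho=\mathsf e_{\rho(k)}$, $q(F,G_1,\dots,G_n)^\rho=q(F,G_1^\rho,\dots,G_n^\rho)$ (the first argument is unchanged). $(ij)$ denotes the transposition exchanging $i$ and $j$ (the identity if $i=j$). Contexts $\Gamma,\Delta$ are finite multisets of formulas, $\Gamma^\rho$ is applied elementwise. A sequent is $\Gamma\vdash_i\Delta$ with $i\in\hat n$; it is provable if derivable with the following rules (premises $\Rightarrow$ conclusion), for all $i,j,k\in\hat n$: (Const) $\Rightarrow\ \vdash_i\mathsf e_i$. (Id) $\Rightarrow X^\pi\vdash_i X^\rho$ whenever $\pi^{ -1}(i)=\rho^{ -1}(i)$. (Sym) $\Gamma^{(ij)}\vdash_i\Delta^{(ij)}\Rightarrow\Gamma\vdash_j\Delta$. (Neg1) if $i\ne k$: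 $\Gamma^{(ij)}\vdash_i F,\Delta^{(ij)}\Rightarrow \Gamma,F^{(jk)}\vdash_j\Delta$. (Neg2) if $j\neq k$: $\Gamma^{(ij)}\vdash_i F,\Delta^{(ij)}\Rightarrow \Gamma,F^{(ik)}\vdash_j\Delta$. (Neg3) $\{\Gamma^{(ij)},F\vdash_i\Delta^{(ij)}\}_{i\neq j}\Rightarrow\Gamma\vdash_j F,\Delta$. (qL) $\{\Gamma^{(ji)},F,G_j^{(ji)}\vdash_j\Delta^{(ji)}\}_{j\in\hat n}\Rightarrow \Gamma,q(F,G_1,\dots,G_n)\vdash_i\Delta$. (qR) $\{\Gamma^{(ji)},F\vdash_j G_j^{(ji)},\Delta^{(ji)}\}_{j\in\hat n}\Rightarrow\Gamma\vdash_i q(F,G_1,\dots,G_n),\Delta$. (Cut) $\Gamma,F\vdash_i\Delta$ and $\Gamma\vdash_i F,\Delta\Rightarrow\Gamma\vdash_i\Delta$. Left and right weakening and contraction in each $\vdash_i$. Semantics: an environment is a function $v:V\to\hat n$; $[\![X^\pi]\!]_v=\pi(v(X))$, $[\![\mathsf e_i]\!]_v=i$, $[\![q(F,G_1,\dots,G_n)]\!]_v=[\![G_k]\!]_v$ where $k=[\![F]\!]_v$. $\Gamma\models_i\Delta$ means: for every environment $v$, if $[\![G]\!]_v=i$ for all $G\in\Gamma$ then $[\![F]\!]_v=i$ for some $F\in\Delta$. -}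

module Defs where

open import Data.Nat using (ℕ)
open import Data.Fin using (Fin; _≟_)
open import Data.Vec using (Vec; lookup; tabulate; map; []; _∷_)
open import Data.Vec.Properties using (lookup∘tabulate)
open import Data.List using (List; []; _∷_)
import Data.List as List
open import Data.List.Relation.Binary.Permutation.Propositional using (_↭_)
open import Data.List.Relation.Unary.All using (All)
open import Data.List.Relation.Unary.Any using (Any)
open import Relation.Binary.PropositionalEquality
open import Relation.Nullary using (yes; no; ¬_)
open import Data.Empty using (⊥-elim)

-- The set ĥn = {1,…,n} is rendered as Fin n (0-based).
-- Propositional variables: V = ℕ (a countable set).

Var : Set
Var = ℕ

-- Permutations of Fin n, represented canonically by their table and the
-- table of their inverse (proofs are irrelevant, so two permutations are
-- propositionally equal iff their tables agree).

record Perm (n : ℕ) : Set where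
  constructor perm
  field
    to    : Vec (Fin n) n
    from  : Vec (Fin n) n
    .left  : ∀ k → lookup from (lookup to k) ≡ k
    .right : ∀ k → lookup to (lookup from k) ≡ k
open Perm public

app : ∀ {n} → Perm n → Fin n → Fin n
app π k = lookup (to π) k

appInv : ∀ {n} → Perm n → Fin n → Fin n
appInv π k = lookup (from π) k

module _ {n : ℕ} (ρt ρf πt πf : Vec (Fin n) n) where
  private
    T = tabulate (λ k → lookup ρt (lookup πt k))
    F = tabulate (λ k → lookup πf (lookup ρf k))

  comp-left : (∀ k → lookup ρf (lookup ρt k) ≡ k) →
              (∀ k → lookup πf (lookup πt k) ≡ k) →
              ∀ k → lookup F (lookup T k) ≡ k
  comp-left ρl πl k =
    trans (cong (lookup F) (lookup∘tabulate (λ k → lookup ρt (lookup πt k)) k))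
    (trans (lookup∘tabulate (λ k → lookup πf (lookup ρf k)) (lookup ρt (lookup πt k)))
    (trans (cong (lookup πf) (ρl (lookup πt k))) (πl k)))

  comp-right : (∀ k → lookup ρt (lookup ρf k) ≡ k) →
               (∀ k → lookup πt (lookup πf k) ≡ k) →
               ∀ k → lookup T (lookup F k) ≡ k
  comp-right ρr πr k =
    trans (cong (lookup T) (lookup∘tabulate (λ k → lookup πf (lookup ρf k)) k))
    (trans (lookup∘tabulate (λ k → lookup ρt (lookup πt k)) (lookup πf (lookup ρf k)))
    (trans (cong (lookup ρt) (πr (lookup ρf k))) (ρr k)))

_∘ₚ_ : ∀ {n} → Perm n → Perm n → Perm n
perm ρt ρf ρl ρr ∘ₚ perm πt πf πl πr =
  perm (tabulate (λ k → lookup ρt (lookup πt k)))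
       (tabulate (λ k → lookup πf (lookup ρf k)))
       (comp-left ρt ρf πt πf ρl πl)
       (comp-right ρt ρf πt πf ρr πr)

swap : ∀ {n} → Fin n → Fin n → Fin n → Fin n
swap i j k with k ≟ i
... | yes _ = j
... | no _ with k ≟ j
...   | yes _ = i
...   | no _ = k

swap-invol : ∀ {n} (i j k : Fin n) → swap i j (swap i j k) ≡ k
swap-invol i j k with k ≟ i
swap-invol i j k | yes k≡i with j ≟ i
... | yes j≡i = trans j≡i (sym k≡i)
... | no _ with j ≟ j
...   | yes _ = sym k≡i
...   | no j≢j = ⊥-elim (j≢j refl)
swap-invol i j k | no k≢i with k ≟ j
swap-invol i j k | no k≢i | yes k≡j with i ≟ i
... | yes _ = sym k≡j
... | no i≢i = ⊥-elim (i≢i refl)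
swap-invol i j k | no k≢i | no k≢j with k ≟ i
... | yes k≡i = ⊥-elim (k≢i k≡i)
... | no _ with k ≟ j
...   | yes k≡j = ⊥-elim (k≢j k≡j)
...   | no _ = refl

transp-inv : ∀ {n} (i j k : Fin n) →
  lookup (tabulate (swap i j)) (lookup (tabulate (swap i j)) k) ≡ k
transp-inv i j k =
  trans (cong (lookup (tabulate (swap i j))) (lookup∘tabulate (swap i j) k))
  (trans (lookup∘tabulate (swap i j) (swap i j k)) (swap-invol i j k))

transp : ∀ {n} → Fin n → Fin n → Perm n
transp i j = perm (tabulate (swap i j)) (tabulate (swap i j))
                  (transp-inv i j) (transp-inv i j)

data Formula (n : ℕ) : Set where
  var : Var → Perm n → Formula n
  e   : Fin n → Formula n
  q   : Formula n → Vec (Formula n) n → Formula n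

mutual
  act : ∀ {n} → Perm n → Formula n → Formula n
  act ρ (var X π) = var X (ρ ∘ₚ π)
  act ρ (e k)     = e (app ρ k)
  act ρ (q F Gs)  = q F (actVec ρ Gs)

  actVec : ∀ {n m} → Perm n → Vec (Formula n) m → Vec (Formula n) m
  actVec ρ []       = []
  actVec ρ (G ∷ Gs) = act ρ G ∷ actVec ρ Gs

_^⟨_,_⟩ : ∀ {n} → Formula n → Fin n → Fin n → Formula n
F ^⟨ i , j ⟩ = act (transp i j) F

-- contexts: finite multisets of formulas, represented as lists taken up to
-- permutation (the calculus below contains an explicit exchange rule)
Ctx : ℕ → Set
Ctx n = List (Formula n)

_^ᶜ⟨_,_⟩ : ∀ {n} → Ctx n → Fin n → Fin n → Ctx n
Γ ^ᶜ⟨ i , j ⟩ = List.map (λ F → F ^⟨ i , j ⟩) Γ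

infix 4 _⊢[_]_

data _⊢[_]_ {n : ℕ} : Ctx n → Fin n → Ctx n → Set where
  Const : ∀ {i} → [] ⊢[ i ] (e i ∷ [])
  Id    : ∀ {i X π ρ} → appInv π i ≡ appInv ρ i →
          (var X π ∷ []) ⊢[ i ] (var X ρ ∷ [])
  Sym   : ∀ {i j Γ Δ} → Γ ^ᶜ⟨ i , j ⟩ ⊢[ i ] Δ ^ᶜ⟨ i , j ⟩ → Γ ⊢[ j ] Δ
  Neg1  : ∀ {i j k Γ Δ F} → ¬ (i ≡ k) →
          Γ ^ᶜ⟨ i , j ⟩ ⊢[ i ] (F ∷ Δ ^ᶜ⟨ i , j ⟩) →
          (F ^⟨ j , k ⟩ ∷ Γ) ⊢[ j ] Δ
  Neg2  : ∀ {i j k Γ Δ F} → ¬ (j ≡ k) →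
          Γ ^ᶜ⟨ i , j ⟩ ⊢[ i ] (F ∷ Δ ^ᶜ⟨ i , j ⟩) →
          (F ^⟨ i , k ⟩ ∷ Γ) ⊢[ j ] Δ
  Neg3  : ∀ {j Γ Δ F} →
          (∀ i → ¬ (i ≡ j) → (F ∷ Γ ^ᶜ⟨ i , j ⟩) ⊢[ i ] Δ ^ᶜ⟨ i , j ⟩) →
          Γ ⊢[ j ] (F ∷ Δ)
  qL    : ∀ {i Γ Δ F Gs} →
          (∀ j → (lookup Gs j ^⟨ j , i ⟩ ∷ F ∷ Γ ^ᶜ⟨ j , i ⟩) ⊢[ j ] Δ ^ᶜ⟨ j , i ⟩) →
          (q F Gs ∷ Γ) ⊢[ i ] Δ
  qR    : ∀ {i Γ Δ F Gs} →
          (∀ j → (F ∷ Γ ^ᶜ⟨ j , i ⟩) ⊢[ j ] (lookup Gs j ^⟨ j , i ⟩ ∷ Δ ^ᶜ⟨ j , i ⟩)) →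
          Γ ⊢[ i ] (q F Gs ∷ Δ)
  Cut   : ∀ {i Γ Δ F} → (F ∷ Γ) ⊢[ i ] Δ → Γ ⊢[ i ] (F ∷ Δ) → Γ ⊢[ i ] Δ
  WeakL : ∀ {i Γ Δ F} → Γ ⊢[ i ] Δ → (F ∷ Γ) ⊢[ i ] Δ
  WeakR : ∀ {i Γ Δ F} → Γ ⊢[ i ] Δ → Γ ⊢[ i ] (F ∷ Δ)
  ContrL : ∀ {i Γ Δ F} → (F ∷ F ∷ Γ) ⊢[ i ] Δ → (F ∷ Γ) ⊢[ i ] Δ
  ContrR : ∀ {i Γ Δ F} → Γ ⊢[ i ] (F ∷ F ∷ Δ) → Γ ⊢[ i ] (F ∷ Δ)
  Exch  : ∀ {i Γ Γ' Δ Δ'} → Γ ↭ Γ' → Δ ↭ Δ' → Γ ⊢[ i ] Δ → Γ' ⊢[ i ] Δ'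

Env : ℕ → Set
Env n = Var → Fin n

-- ⟦ q(F,G_1,…,G_n) ⟧ = ⟦ G_k ⟧ with k = ⟦ F ⟧ (written via the pointwise
-- evaluation of the vector of G's, to satisfy the termination checker)
mutual
  ⟦_⟧ : ∀ {n} → Formula n → Env n → Fin n
  ⟦ var X π ⟧ v = app π (v X)
  ⟦ e i ⟧     v = i
  ⟦ q F Gs ⟧  v = lookup (⟦ Gs ⟧ᵛ v) (⟦ F ⟧ v)

  ⟦_⟧ᵛ : ∀ {n m} → Vec (Formula n) m → Env n → Vec (Fin n) m
  ⟦ [] ⟧ᵛ     v = []
  ⟦ G ∷ Gs ⟧ᵛ v = ⟦ G ⟧ v ∷ ⟦ Gs ⟧ᵛ v

infix 4 _⊨[_]_

_⊨[_]_ : ∀ {n} → Ctx n → Fin n → Ctx n → Set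
Γ ⊨[ i ] Δ = ∀ v → All (λ G → ⟦ G ⟧ v ≡ i) Γ → Any (λ F → ⟦ F ⟧ v ≡ i) Δ

-- Soundness is a rule-by-rule check: a transposition (i j) of all formulas exchanges the
-- values i and j. For completeness, split (by Cut and Neg3) on the value of every variable
-- of the sequent. Each branch adds literals fixing an environment v, and from these literals
-- every formula is decided at v: one whose value is i is derived by recursion on its q-tree
-- (qR, refuting the branches not selected by the condition), and one whose value is c ≠ i is
-- refuted through Neg2 from a derivation of it at c. So a branch either refutes a hypothesis
-- false under v or, by the semantic assumption, derives the conclusion.
module Submission where

open import Defs
open import Data.Nat using (ℕ; _≤_)
import Data.Nat as ℕ
open import Data.Fin using (Fin; zero; suc; _≟_)
open import Data.Vec using (Vec; lookup; []; _∷_)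
open import Data.Vec.Properties using (lookup∘tabulate; tabulate∘lookup; tabulate-cong)
open import Data.List using (List; []; _∷_; _++_)
open import Data.List.Properties using (map-∘; map-cong; map-id)
open import Data.List.Membership.Propositional using (_∈_; find)
open import Data.List.Membership.Propositional.Properties using (∈-map⁺; ∈-++⁺ˡ; ∈-++⁺ʳ; ∈-∃++)
open import Data.List.Relation.Unary.All as All using (All; []; _∷_; all?)
open import Data.List.Relation.Unary.All.Properties as All using (¬All⇒Any¬)
open import Data.List.Relation.Unary.Any as Any using (Any; here; there)
import Data.List.Relation.Unary.Any.Properties as Any
open import Data.List.Relation.Binary.Permutation.Propositional using (↭-sym; ↭-refl; ↭-trans)
open import Data.List.Relation.Binary.Permutation.Propositional.Properties
  using (All-resp-↭; Any-resp-↭; shift; ++-comm; ++⁺ˡ)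
open import Data.Product using (_×_; _,_; Σ)
open import Function using (_∘_)
open import Relation.Binary.PropositionalEquality
open import Relation.Nullary using (Dec; yes; no; ¬_; contradiction)
open import Relation.Nullary.Decidable using (recompute)

app-∘ₚ : ∀ {n} (ρ π : Perm n) k → app (ρ ∘ₚ π) k ≡ app ρ (app π k)
app-∘ₚ (perm ρt _ _ _) (perm πt _ _ _) = lookup∘tabulate (λ k → lookup ρt (lookup πt k))

app-transp : ∀ {n} (i j k : Fin n) → app (transp i j) k ≡ swap i j k
app-transp i j = lookup∘tabulate (swap i j)

appInv∘app : ∀ {n} (π : Perm n) k → appInv π (app π k) ≡ k
appInv∘app (perm t f l _) k = recompute (lookup f (lookup t k) ≟ k) (l k)

app∘appInv : ∀ {n} (π : Perm n) k → app π (appInv π k) ≡ k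
app∘appInv (perm t f _ r) k = recompute (lookup t (lookup f k) ≟ k) (r k)

app⇒appInv : ∀ {n} (π : Perm n) {k i} → app π k ≡ i → appInv π i ≡ k
app⇒appInv π {k} refl = appInv∘app π k

appInv⇒app : ∀ {n} (π : Perm n) {k i} → appInv π i ≡ k → app π k ≡ i
appInv⇒app π {i = i} refl = app∘appInv π i

lookup-ext : ∀ {A : Set} {n} {xs ys : Vec A n} → (∀ k → lookup xs k ≡ lookup ys k) → xs ≡ ys
lookup-ext {xs = xs} {ys} eq = trans (sym (tabulate∘lookup xs)) (trans (tabulate-cong eq) (tabulate∘lookup ys))

perm-≡ : ∀ {n} {π ρ : Perm n} → to π ≡ to ρ → from π ≡ from ρ → π ≡ ρ
perm-≡ {π = perm _ _ _ _} {perm _ _ _ _} refl refl = refl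

perm-ext : ∀ {n} {π ρ : Perm n} → (∀ k → app π k ≡ app ρ k) → π ≡ ρ
perm-ext {π = π} {ρ} eq = perm-≡ (lookup-ext eq) (lookup-ext inverses-agree)
  where
  inverses-agree : ∀ k → appInv π k ≡ appInv ρ k
  inverses-agree k = sym (app⇒appInv ρ (trans (sym (eq (appInv π k))) (app∘appInv π k)))

∘ₚ-assoc : ∀ {n} (ρ π σ : Perm n) → ρ ∘ₚ (π ∘ₚ σ) ≡ (ρ ∘ₚ π) ∘ₚ σ
∘ₚ-assoc ρ π σ = perm-ext λ k → begin
  app (ρ ∘ₚ (π ∘ₚ σ)) k      ≡⟨ app-∘ₚ ρ (π ∘ₚ σ) k ⟩
  app ρ (app (π ∘ₚ σ) k)     ≡⟨ cong (app ρ) (app-∘ₚ π σ k) ⟩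
  app ρ (app π (app σ k))    ≡⟨ app-∘ₚ ρ π (app σ k) ⟨
  app (ρ ∘ₚ π) (app σ k)     ≡⟨ app-∘ₚ (ρ ∘ₚ π) σ k ⟨
  app ((ρ ∘ₚ π) ∘ₚ σ) k      ∎
  where open ≡-Reasoning

swap-fst : ∀ {n} (i j : Fin n) → swap i j i ≡ j
swap-fst i j with i ≟ i
... | yes _ = refl
... | no i≢i = contradiction refl i≢i

swap-snd : ∀ {n} (i j : Fin n) → swap i j j ≡ i
swap-snd i j with j ≟ i
... | yes j≡i = j≡i
... | no _ with j ≟ j
...   | yes _ = refl
...   | no j≢j = contradiction refl j≢j

swap-other : ∀ {n} (i j k : Fin n) → ¬ k ≡ i → ¬ k ≡ j → swap i j k ≡ k
swap-other i j k k≢i k≢j with k ≟ i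
... | yes k≡i = contradiction k≡i k≢i
... | no _ with k ≟ j
...   | yes k≡j = contradiction k≡j k≢j
...   | no _ = refl

swap-self : ∀ {n} (i k : Fin n) → swap i i k ≡ k
swap-self i k with k ≟ i
... | yes k≡i = sym k≡i
... | no _ with k ≟ i
...   | yes k≡i = sym k≡i
...   | no _ = refl

swap-comm : ∀ {n} (i j k : Fin n) → swap i j k ≡ swap j i k
swap-comm i j k = by-cases (k ≟ i) (k ≟ j)
  where
  by-cases : Dec (k ≡ i) → Dec (k ≡ j) → swap i j k ≡ swap j i k
  by-cases (yes refl) _          = trans (swap-fst k j) (sym (swap-snd j k))
  by-cases (no _)     (yes refl) = trans (swap-snd i k) (sym (swap-fst k i))
  by-cases (no k≢i)   (no k≢j)   =
    trans (swap-other i j k k≢i k≢j) (sym (swap-other j i k k≢j k≢i))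

swap≡i⇒≡j : ∀ {n} {i j k : Fin n} → swap i j k ≡ i → k ≡ j
swap≡i⇒≡j {i = i} {j} {k} eq = trans (sym (swap-invol i j k)) (trans (cong (swap i j) eq) (swap-fst i j))

transp-self : ∀ {n} (i k : Fin n) → app (transp i i) k ≡ k
transp-self i k = trans (app-transp i i k) (swap-self i k)

transp-invol : ∀ {n} (i j k : Fin n) → app (transp i j ∘ₚ transp j i) k ≡ k
transp-invol i j k = begin
  app (transp i j ∘ₚ transp j i) k         ≡⟨ app-∘ₚ (transp i j) (transp j i) k ⟩
  app (transp i j) (app (transp j i) k)    ≡⟨ app-transp i j _ ⟩
  swap i j (app (transp j i) k)            ≡⟨ cong (swap i j) (app-transp j i k) ⟩
  swap i j (swap j i k)                    ≡⟨ cong (swap i j) (swap-comm j i k) ⟩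
  swap i j (swap i j k)                    ≡⟨ swap-invol i j k ⟩
  k                                        ∎
  where open ≡-Reasoning

mutual
  act-∘ₚ : ∀ {n} (ρ π : Perm n) G → act ρ (act π G) ≡ act (ρ ∘ₚ π) G
  act-∘ₚ ρ π (var X σ) = cong (var X) (∘ₚ-assoc ρ π σ)
  act-∘ₚ ρ π (e k)     = cong e (sym (app-∘ₚ ρ π k))
  act-∘ₚ ρ π (q F Gs)  = cong (q F) (actVec-∘ₚ ρ π Gs)

  actVec-∘ₚ : ∀ {n m} (ρ π : Perm n) (Gs : Vec (Formula n) m) →
              actVec ρ (actVec π Gs) ≡ actVec (ρ ∘ₚ π) Gs
  actVec-∘ₚ ρ π []       = refl
  actVec-∘ₚ ρ π (G ∷ Gs) = cong₂ _∷_ (act-∘ₚ ρ π G) (actVec-∘ₚ ρ π Gs)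

mutual
  act-identity : ∀ {n} (ρ : Perm n) → (∀ k → app ρ k ≡ k) → ∀ G → act ρ G ≡ G
  act-identity ρ id (var X σ) = cong (var X) (perm-ext λ k → trans (app-∘ₚ ρ σ k) (id (app σ k)))
  act-identity ρ id (e k)     = cong e (id k)
  act-identity ρ id (q F Gs)  = cong (q F) (actVec-identity ρ id Gs)

  actVec-identity : ∀ {n m} (ρ : Perm n) → (∀ k → app ρ k ≡ k) →
                    ∀ (Gs : Vec (Formula n) m) → actVec ρ Gs ≡ Gs
  actVec-identity ρ id []       = refl
  actVec-identity ρ id (G ∷ Gs) = cong₂ _∷_ (act-identity ρ id G) (actVec-identity ρ id Gs)

^-self : ∀ {n} (i : Fin n) G → G ^⟨ i , i ⟩ ≡ G
^-self i = act-identity (transp i i) (transp-self i)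

^-invol : ∀ {n} (i j : Fin n) G → (G ^⟨ j , i ⟩) ^⟨ i , j ⟩ ≡ G
^-invol i j G =
  trans (act-∘ₚ (transp i j) (transp j i) G) (act-identity _ (transp-invol i j) G)

^ᶜ-invol : ∀ {n} (i j : Fin n) Γ → (Γ ^ᶜ⟨ j , i ⟩) ^ᶜ⟨ i , j ⟩ ≡ Γ
^ᶜ-invol i j Γ = trans (sym (map-∘ Γ)) (trans (map-cong (^-invol i j) Γ) (map-id Γ))

Holds : ∀ {n} → Env n → Fin n → Formula n → Set
Holds v i G = ⟦ G ⟧ v ≡ i

mutual
  ⟦act⟧ : ∀ {n} (ρ : Perm n) (v : Env n) G → ⟦ act ρ G ⟧ v ≡ app ρ (⟦ G ⟧ v)
  ⟦act⟧ ρ v (var X π) = app-∘ₚ ρ π (v X)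
  ⟦act⟧ ρ v (e k)     = refl
  ⟦act⟧ ρ v (q F Gs)  = lookup-⟦actVec⟧ ρ v Gs (⟦ F ⟧ v)

  lookup-⟦actVec⟧ : ∀ {n m} (ρ : Perm n) (v : Env n) (Gs : Vec (Formula n) m) c →
                    lookup (⟦ actVec ρ Gs ⟧ᵛ v) c ≡ app ρ (lookup (⟦ Gs ⟧ᵛ v) c)
  lookup-⟦actVec⟧ ρ v (G ∷ Gs) zero    = ⟦act⟧ ρ v G
  lookup-⟦actVec⟧ ρ v (G ∷ Gs) (suc c) = lookup-⟦actVec⟧ ρ v Gs c

⟦^⟧ : ∀ {n} (i j : Fin n) (v : Env n) G → ⟦ G ^⟨ i , j ⟩ ⟧ v ≡ swap i j (⟦ G ⟧ v)
⟦^⟧ i j v G = trans (⟦act⟧ (transp i j) v G) (app-transp i j _)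

lookup-⟦⟧ᵛ : ∀ {n m} (Gs : Vec (Formula n) m) (v : Env n) c → lookup (⟦ Gs ⟧ᵛ v) c ≡ ⟦ lookup Gs c ⟧ v
lookup-⟦⟧ᵛ (G ∷ Gs) v zero    = refl
lookup-⟦⟧ᵛ (G ∷ Gs) v (suc c) = lookup-⟦⟧ᵛ Gs v c

Holds-^ : ∀ {n} {i j : Fin n} {v} G → Holds v j G → Holds v i (G ^⟨ i , j ⟩)
Holds-^ {i = i} {j} {v} G refl = trans (⟦^⟧ i j v G) (swap-snd i j)

Holds-^⁻ : ∀ {n} {i j : Fin n} {v} G → Holds v i (G ^⟨ i , j ⟩) → Holds v j G
Holds-^⁻ {i = i} {j} {v} G holds = swap≡i⇒≡j (trans (sym (⟦^⟧ i j v G)) holds)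

All-^ᶜ : ∀ {n} {i j : Fin n} {v Γ} → All (Holds v j) Γ → All (Holds v i) (Γ ^ᶜ⟨ i , j ⟩)
All-^ᶜ {i = i} {j} {v} = All.map⁺ ∘ All.map (λ {G} → Holds-^ {i = i} {j} {v} G)

Any-^ᶜ⁻ : ∀ {n} {i j : Fin n} {v Δ} → Any (Holds v i) (Δ ^ᶜ⟨ i , j ⟩) → Any (Holds v j) Δ
Any-^ᶜ⁻ {i = i} {j} {v} = Any.map (λ {G} → Holds-^⁻ {i = i} {j} {v} G) ∘ Any.map⁻

sound : ∀ {n} {Γ : Ctx n} {i Δ} → Γ ⊢[ i ] Δ → Γ ⊨[ i ] Δ
sound Const v _ = here refl
sound (Id {π = π} {ρ} π⁻¹i≡ρ⁻¹i) v (πvX≡i ∷ []) =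
  here (appInv⇒app ρ (trans (sym π⁻¹i≡ρ⁻¹i) (app⇒appInv π πvX≡i)))
sound (Sym d) v Γ-true = Any-^ᶜ⁻ (sound d v (All-^ᶜ Γ-true))
sound (Neg1 {F = F} i≢k d) v (F^jk-true ∷ Γ-true) with sound d v (All-^ᶜ Γ-true)
... | here F-true = contradiction (trans (sym F-true) (Holds-^⁻ F F^jk-true)) i≢k
... | there Δ-true = Any-^ᶜ⁻ Δ-true
sound (Neg2 {i} {k = k} {F = F} j≢k d) v (F^ik-true ∷ Γ-true) with sound d v (All-^ᶜ Γ-true)
... | here F-true = contradiction
        (trans (sym F^ik-true) (trans (⟦^⟧ i k v F) (trans (cong (swap i k) F-true) (swap-fst i k))))
        j≢k
... | there Δ-true = Any-^ᶜ⁻ Δ-true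
sound (Neg3 {j} {F = F} d) v Γ-true with ⟦ F ⟧ v ≟ j
... | yes F-true = here F-true
... | no F≢j = there (Any-^ᶜ⁻ (sound (d _ F≢j) v (refl ∷ All-^ᶜ Γ-true)))
sound (qL {F = F} {Gs} d) v (q-true ∷ Γ-true) =
  Any-^ᶜ⁻ (sound (d c) v (Holds-^ (lookup Gs c) Gc-true ∷ refl ∷ All-^ᶜ Γ-true))
  where
  c = ⟦ F ⟧ v
  Gc-true = trans (sym (lookup-⟦⟧ᵛ Gs v c)) q-true
sound (qR {F = F} {Gs} d) v Γ-true with sound (d (⟦ F ⟧ v)) v (refl ∷ All-^ᶜ Γ-true)
... | here Gc-true = here (trans (lookup-⟦⟧ᵛ Gs v _) (Holds-^⁻ (lookup Gs _) Gc-true))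
... | there Δ-true = there (Any-^ᶜ⁻ Δ-true)
sound (Cut d₁ d₂) v Γ-true with sound d₂ v Γ-true
... | here F-true = sound d₁ v (F-true ∷ Γ-true)
... | there Δ-true = Δ-true
sound (WeakL d) v (_ ∷ Γ-true) = sound d v Γ-true
sound (WeakR d) v Γ-true = there (sound d v Γ-true)
sound (ContrL d) v (F-true ∷ Γ-true) = sound d v (F-true ∷ F-true ∷ Γ-true)
sound (ContrR d) v Γ-true with sound d v Γ-true
... | here F-true = here F-true
... | there Δ-true = Δ-true
sound (Exch Γ↭ Δ↭ d) v Γ-true = Any-resp-↭ Δ↭ (sound d v (All-resp-↭ (↭-sym Γ↭) Γ-true))

weakenˡ-++ : ∀ {n} {i : Fin n} {Γ Δ} Γ' → Γ ⊢[ i ] Δ → (Γ' ++ Γ) ⊢[ i ] Δ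
weakenˡ-++ []       d = d
weakenˡ-++ (_ ∷ Γ') d = WeakL (weakenˡ-++ Γ' d)

weakenʳ-++ : ∀ {n} {i : Fin n} {Γ Δ} Γ' → Γ ⊢[ i ] Δ → (Γ ++ Γ') ⊢[ i ] Δ
weakenʳ-++ {Γ = Γ} Γ' d = Exch (++-comm Γ' Γ) ↭-refl (weakenˡ-++ Γ' d)

⊢-∈ : ∀ {n} {i : Fin n} {Γ Γ' Δ G} → G ∈ Γ → (G ∷ Γ') ⊢[ i ] Δ → (Γ' ++ Γ) ⊢[ i ] Δ
⊢-∈ {Γ' = Γ'} {G = G} G∈Γ d with ys , zs , refl ← ∈-∃++ G∈Γ =
  Exch (↭-trans (↭-sym (shift G Γ' (ys ++ zs))) (++⁺ˡ Γ' (↭-sym (shift G ys zs)))) ↭-refl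
       (weakenʳ-++ (ys ++ zs) d)

⊢-^ᶜ : ∀ {n} {i j : Fin n} {Γ Δ} → Γ ⊢[ i ] Δ → Γ ^ᶜ⟨ j , i ⟩ ⊢[ j ] Δ ^ᶜ⟨ j , i ⟩
⊢-^ᶜ {i = i} {j} {Γ} {Δ} d =
  Sym {i = i} (subst₂ (λ Γ' Δ' → Γ' ⊢[ i ] Δ') (sym (^ᶜ-invol i j Γ)) (sym (^ᶜ-invol i j Δ)) d)

refute : ∀ {n} {j c : Fin n} {Γ F} → ¬ j ≡ c → Γ ^ᶜ⟨ c , j ⟩ ⊢[ c ] (F ∷ []) → (F ∷ Γ) ⊢[ j ] []
refute {c = c} {Γ} {F} j≢c d = subst (λ H → (H ∷ Γ) ⊢[ _ ] []) (^-self c F) (Neg2 j≢c d)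

mutual
  vars : ∀ {n} → Formula n → List Var
  vars (var X _) = X ∷ []
  vars (e _)     = []
  vars (q F Gs)  = vars F ++ varsᵛ Gs

  varsᵛ : ∀ {n m} → Vec (Formula n) m → List Var
  varsᵛ []       = []
  varsᵛ (G ∷ Gs) = vars G ++ varsᵛ Gs

varsᶜ : ∀ {n} → Ctx n → List Var
varsᶜ []      = []
varsᶜ (G ∷ Γ) = vars G ++ varsᶜ Γ

varsᵛ-lookup : ∀ {n m} (Gs : Vec (Formula n) m) c {X} → X ∈ vars (lookup Gs c) → X ∈ varsᵛ Gs
varsᵛ-lookup (G ∷ Gs) zero    X∈G = ∈-++⁺ˡ X∈G
varsᵛ-lookup (G ∷ Gs) (suc c) X∈G = ∈-++⁺ʳ (vars G) (varsᵛ-lookup Gs c X∈G)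

varsᶜ-∈ : ∀ {n} {G : Formula n} {Γ X} → G ∈ Γ → X ∈ vars G → X ∈ varsᶜ Γ
varsᶜ-∈ (here refl)            X∈G = ∈-++⁺ˡ X∈G
varsᶜ-∈ {Γ = G' ∷ _} (there G∈Γ) X∈G = ∈-++⁺ʳ (vars G') (varsᶜ-∈ G∈Γ X∈G)

Pinned : ∀ {n} → Fin n → Env n → Ctx n → Var → Set
Pinned {n} i v Γ X = Σ (Perm n) λ σ → var X σ ∈ Γ × Holds v i (var X σ)

Pins : ∀ {n} → Fin n → Env n → Ctx n → List Var → Set
Pins i v Γ xs = ∀ {X} → X ∈ xs → Pinned i v Γ X

Pins-^ᶜ : ∀ {n} {i j : Fin n} {v Γ xs} → Pins i v Γ xs → Pins j v (Γ ^ᶜ⟨ j , i ⟩) xs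
Pins-^ᶜ {i = i} {j} {v} pins X∈xs with σ , X∈Γ , holds ← pins X∈xs =
  transp j i ∘ₚ σ , ∈-map⁺ _ X∈Γ , Holds-^ {v = v} (var _ σ) holds

mutual
  derive-true : ∀ {n} {i : Fin n} {v Γ} F → Pins i v Γ (vars F) → Holds v i F → Γ ⊢[ i ] (F ∷ [])
  derive-true (var X π) pins πvX≡i with σ , X∈Γ , σvX≡i ← pins (here refl) =
    ⊢-∈ X∈Γ (Id (trans (app⇒appInv σ σvX≡i) (sym (app⇒appInv π πvX≡i))))
  derive-true {Γ = Γ} (e k) _ refl = weakenʳ-++ Γ Const
  derive-true {i = i} {v} {Γ} (q F Gs) pins Gc-true = qR branch
    where
    c = ⟦ F ⟧ v
    branch : ∀ j → (F ∷ Γ ^ᶜ⟨ j , i ⟩) ⊢[ j ] (lookup Gs j ^⟨ j , i ⟩ ∷ [])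
    branch j with c ≟ j
    ... | yes refl = WeakL (⊢-^ᶜ (derive-lookup Gs c pins-Gc Gc-true))
      where
      pins-Gc : Pins i v Γ (vars (lookup Gs c))
      pins-Gc X∈Gc = pins (∈-++⁺ʳ (vars F) (varsᵛ-lookup Gs c X∈Gc))
    ... | no c≢j = WeakR (refute (c≢j ∘ sym) (derive-true F (Pins-^ᶜ (Pins-^ᶜ pins-F)) refl))
      where
      pins-F : Pins i v Γ (vars F)
      pins-F X∈F = pins (∈-++⁺ˡ X∈F)

  derive-lookup : ∀ {n m} {i : Fin n} {v Γ} (Gs : Vec (Formula n) m) c →
                  Pins i v Γ (vars (lookup Gs c)) → lookup (⟦ Gs ⟧ᵛ v) c ≡ i →
                  Γ ⊢[ i ] (lookup Gs c ∷ [])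
  derive-lookup (G ∷ _)  zero    = derive-true G
  derive-lookup (_ ∷ Gs) (suc c) = derive-lookup Gs c

-- lit i x k holds at i exactly when x has the value k.
lit : ∀ {n} → Fin n → Var → Fin n → Formula n
lit i x k = var x (transp i k)

lit-^ : ∀ {n} (i j : Fin n) x → lit i x j ^⟨ j , i ⟩ ≡ lit i x i
lit-^ i j x = cong (var x) (perm-ext λ k → trans (transp-invol j i k) (sym (transp-self i k)))

-- Cut on lit i x i: its left premise is the case k = i, and its right premise, by Neg3,
-- needs the cases k ≠ i, transposed so that they are sequents at k.
⊢-cases : ∀ {n} {i : Fin n} {Γ Δ} x → (∀ k → (lit i x k ∷ Γ) ⊢[ i ] Δ) → Γ ⊢[ i ] Δ
⊢-cases {i = i} {Γ} {Δ} x cases = Cut (cases i) (Neg3 λ j _ →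
  subst (λ H → (H ∷ Γ ^ᶜ⟨ j , i ⟩) ⊢[ j ] Δ ^ᶜ⟨ j , i ⟩) (lit-^ i j x) (⊢-^ᶜ (cases j)))

Assignment : ℕ → List Var → Set
Assignment n xs = All (λ _ → Fin n) xs

literals : ∀ {n} → Fin n → (xs : List Var) → Assignment n xs → Ctx n
literals i []       []       = []
literals i (x ∷ xs) (k ∷ ks) = lit i x k ∷ literals i xs ks

⊢-cases* : ∀ {n} {i : Fin n} {Γ Δ} xs → (∀ ks → (literals i xs ks ++ Γ) ⊢[ i ] Δ) → Γ ⊢[ i ] Δ
⊢-cases* []                   cases = cases []
⊢-cases* {i = i} {Γ} (x ∷ xs) cases = ⊢-cases x λ k → ⊢-cases* xs λ ks →
  Exch (↭-sym (shift (lit i x k) (literals i xs ks) Γ)) ↭-refl (cases (k ∷ ks))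

assign : ∀ {n} → Fin n → (xs : List Var) → Assignment n xs → Env n
assign d []       []       y = d
assign d (x ∷ xs) (k ∷ ks) y with y ℕ.≟ x
... | yes _ = k
... | no _  = assign d xs ks y

literals-pin : ∀ {n} (i : Fin n) xs ks → Pins i (assign i xs ks) (literals i xs ks) xs
literals-pin i (x ∷ xs) (k ∷ ks) {X} X∈xs with X ℕ.≟ x
literals-pin i (x ∷ xs) (k ∷ ks) X∈xs | yes refl =
  transp i k , here refl , trans (app-transp i k k) (swap-snd i k)
literals-pin i (x ∷ xs) (k ∷ ks) (here X≡x) | no X≢x = contradiction X≡x X≢x
literals-pin i (x ∷ xs) (k ∷ ks) (there X∈xs) | no _
  with σ , X∈L , holds ← literals-pin i xs ks X∈xs = σ , there X∈L , holds

complete-at : ∀ {n} {i : Fin n} {v L} Γ F → Pins i v L (vars F ++ varsᶜ Γ) →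
              (All (Holds v i) Γ → Any (Holds v i) (F ∷ [])) → (L ++ Γ) ⊢[ i ] (F ∷ [])
complete-at {i = i} {v} {L} Γ F pins ⊨F with all? (λ G → ⟦ G ⟧ v ≟ i) Γ
... | yes Γ-true with here F-true ← ⊨F Γ-true =
  weakenʳ-++ Γ (derive-true F (λ X∈F → pins (∈-++⁺ˡ X∈F)) F-true)
... | no Γ-false with G , G∈Γ , G-false ← find (¬All⇒Any¬ (λ G → ⟦ G ⟧ v ≟ i) Γ Γ-false) =
  ⊢-∈ G∈Γ (WeakR (refute (G-false ∘ sym) (derive-true G (Pins-^ᶜ pins-G) refl)))
  where
  pins-G : Pins i v L (vars G)
  pins-G X∈G = pins (∈-++⁺ʳ (vars F) (varsᶜ-∈ G∈Γ X∈G))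

complete : ∀ {n} {i : Fin n} Γ F → Γ ⊨[ i ] (F ∷ []) → Γ ⊢[ i ] (F ∷ [])
complete {i = i} Γ F ⊨F = ⊢-cases* xs λ ks →
  complete-at Γ F (literals-pin i xs ks) (⊨F (assign i xs ks))
  where
  xs = vars F ++ varsᶜ Γ

theorem4p11 : (n : ℕ) → 2 ≤ n → (i : Fin n) (Γ : Ctx n) (F : Formula n) →
    ((Γ ⊨[ i ] (F ∷ [])) → (Γ ⊢[ i ] (F ∷ []))) × ((Γ ⊢[ i ] (F ∷ [])) → (Γ ⊨[ i ] (F ∷ [])))
theorem4p11 n _ i Γ F = complete Γ F , sound
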